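{- $\gamma^{L\text{ - }LD}(\mathcal{T})\in\left[\frac{2}{11},\frac{2}{9}\right]$.
   Context: The triangular grid $\mathcal{T}$ has vertex set $\mathbb{Z}^2$, with $\mathbf{u},\mathbf{v}$ adjacent iff $\mathbf{u}-\mathbf{v}\in\{(\pm1,0),(0,\pm1),(1,1),(-1,-1)\}$. For a vertex $u$, $N[u]$ is its closed neighbourhood; for a code (nonempty vertex subset) $C$, $I_C(u)=N[u]\cap C$. $C$ is a covering code if $I_C(u)\neq\emptyset$ for all $u$, and a local locating-dominating code if it is covering and $I_C(u)\neq I_C(v)$ for all adjacent $u,v\notin C$. The density of $C\subseteq\mathbb{Z}^2$ is $D(C)=\limsup_{n\to\infty}\frac{|C\cap Q_n|}{|Q_n|}$ with $Q_n=\{(i,j)\in\mathbb{Z}^2: |i|\leq n,|j|\leq n\}$. $\gamma^{L\text{ - }LD}(\mathcal{T})$ is the smallest (infimum) density of a local locating-dominating code in $\mathcal{T}$. -}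

module Defs where

open import Data.Bool using (Bool; true; false)
open import Data.Nat as ℕ using (ℕ; suc; _≥_)
open import Data.Integer as ℤ using (ℤ; +_; -[1+_])
open import Data.Rational as ℚ using (ℚ)
open import Data.List using (List; upTo; map; concatMap; filter; length)
open import Data.Product using (_×_; _,_; proj₁; proj₂; Σ; ∃; ∃-syntax)
open import Data.Sum using (_⊎_)
open import Data.Empty using (⊥)
open import Relation.Nullary using (¬_)
open import Relation.Binary.PropositionalEquality using (_≡_)
open import Data.Bool.Properties using (T?)
open import Data.Bool using (T)

-- Vertices of the triangular grid 𝒯
Vertex : Set
Vertex = ℤ × ℤ

Adj : Vertex → Vertex → Set
Adj (a , b) (c , d) =
  let x = a ℤ.- c ; y = b ℤ.- d in
  ((x , y) ≡ (+ 1 , + 0)) ⊎ ((x , y) ≡ (-[1+ 0 ] , + 0)) ⊎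
  ((x , y) ≡ (+ 0 , + 1)) ⊎ ((x , y) ≡ (+ 0 , -[1+ 0 ])) ⊎
  ((x , y) ≡ (+ 1 , + 1)) ⊎ ((x , y) ≡ (-[1+ 0 ] , -[1+ 0 ]))

InN : Vertex → Vertex → Set
InN u w = (w ≡ u) ⊎ Adj u w

Code : Set
Code = Vertex → Bool

_∈C_ : Vertex → Code → Set
w ∈C C = C w ≡ true

InI : Code → Vertex → Vertex → Set
InI C u w = InN u w × (w ∈C C)

SameI : Code → Vertex → Vertex → Set
SameI C u v = ∀ w → (InI C u w → InI C v w) × (InI C v w → InI C u w)

IsCovering : Code → Set
IsCovering C = ∀ u → ∃[ w ] InI C u w

IsLocalLD : Code → Set
IsLocalLD C =
  IsCovering C ×
  (∀ u v → Adj u v → ¬ (u ∈C C) → ¬ (v ∈C C) → ¬ SameI C u v)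

interval : ℕ → List ℤ
interval n = map (λ k → (+ k) ℤ.- (+ n)) (upTo (suc (2 ℕ.* n)))

box : ℕ → List Vertex
box n = concatMap (λ i → map (λ j → (i , j)) (interval n)) (interval n)

countIn : Code → ℕ → ℕ
countIn C n = length (filter (λ w → T? (C w)) (box n))

sizeQ : ℕ → ℕ
sizeQ n = suc (2 ℕ.* n) ℕ.* suc (2 ℕ.* n)

ratio : Code → ℕ → ℚ
ratio C n = (+ countIn C n) ℚ./ sizeQ n

-- D(C) ≥ x, i.e. limsup_n ratio ≥ x
DensityAtLeast : Code → ℚ → Set
DensityAtLeast C x =
  ∀ (ε : ℚ) → ℚ.Positive ε → ∀ (N : ℕ) → ∃[ n ] (n ≥ N × (x ℚ.- ε) ℚ.≤ ratio C n)

-- D(C) ≤ x, i.e. limsup_n ratio ≤ x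
DensityAtMost : Code → ℚ → Set
DensityAtMost C x =
  ∀ (ε : ℚ) → ℚ.Positive ε → ∃[ N ] (∀ n → n ≥ N → ratio C n ℚ.≤ x ℚ.+ ε)

-- Lower bound, by discharging. Let every vertex u send share |I(u)| to each codeword of I(u), where
-- share 1 = 2 and share k = 1 otherwise; then u sends at least 2. A codeword c receives at most 2
-- from itself, and its six neighbours split into three adjacent pairs, each sending at most 3: two
-- adjacent non-codewords whose only codeword is c would have equal I-sets. So c receives at most 11,
-- and as everything sent from Q_n lands in Q_(n+1), 2 |Q_n| ≤ 11 |C ∩ Q_(n+1)|.
-- Upper bound: C = {(x, y) : x + 2y ≡ 0 or 3 (mod 9)}. A row meets C twice in every nine consecutive
-- vertices, and C is local locating-dominating because the neighbourhood of u, seen through x + 2y,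
-- only depends on the residue of u; the nine residues are checked by evaluation.
module Submission where

open import Defs

module Sums where

  open import Data.Nat using (ℕ; zero; suc; _+_; _*_; _≤_; z≤n; s≤s; NonZero)
  open import Data.Nat.Properties
    using (<⇒≤; +-mono-≤; +-monoʳ-≤; +-monoˡ-≤; *-monoʳ-≤; m≤n+m; +-assoc; +-comm; *-zeroʳ; *-distribˡ-+; module ≤-Reasoning)
  open import Data.Nat.DivMod using (_/_; _%_; m≡m%n+[m/n]*n; m%n<n; m/n*n≤m)
  open import Data.Nat.Tactic.RingSolver using (solve-∀)
  open import Data.Nat.ListAction using (sum)
  open import Data.Nat.ListAction.Properties using (sum-++)
  open import Data.Bool using (Bool; true; false)
  open import Data.Bool.Properties using (T?)
  open import Data.List using (List; []; _∷_; _++_; map; filter; length; concatMap; applyUpTo)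
  open import Data.List.Properties using (map-∘; map-++)
  open import Data.List.Membership.Propositional using (_∈_)
  open import Data.List.Relation.Unary.Any using (here; there)
  open import Function using (_∘_)
  open import Relation.Binary.PropositionalEquality

  ∑< : ℕ → (ℕ → ℕ) → ℕ
  ∑< zero    f = 0
  ∑< (suc m) f = f 0 + ∑< m (f ∘ suc)

  syntax ∑< m (λ i → e) = ∑[ i < m ] e

  ∑-cong : ∀ m {f g : ℕ → ℕ} → (∀ i → f i ≡ g i) → ∑< m f ≡ ∑< m g
  ∑-cong zero    f≗g = refl
  ∑-cong (suc m) f≗g = cong₂ _+_ (f≗g 0) (∑-cong m (f≗g ∘ suc))

  ∑-mono-≤ : ∀ m {f g : ℕ → ℕ} → (∀ i → f i ≤ g i) → ∑< m f ≤ ∑< m g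
  ∑-mono-≤ zero    f≤g = z≤n
  ∑-mono-≤ (suc m) f≤g = +-mono-≤ (f≤g 0) (∑-mono-≤ m (f≤g ∘ suc))

  ∑-const : ∀ m k → ∑[ i < m ] k ≡ m * k
  ∑-const zero    k = refl
  ∑-const (suc m) k = cong (k +_) (∑-const m k)

  ∑-*ˡ : ∀ m k (f : ℕ → ℕ) → ∑[ i < m ] (k * f i) ≡ k * ∑< m f
  ∑-*ˡ zero    k f = sym (*-zeroʳ k)
  ∑-*ˡ (suc m) k f = trans (cong (k * f 0 +_) (∑-*ˡ m k (f ∘ suc))) (sym (*-distribˡ-+ k (f 0) _))

  ∑-+ : ∀ m (f g : ℕ → ℕ) → ∑[ i < m ] (f i + g i) ≡ ∑< m f + ∑< m g
  ∑-+ zero    f g = refl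
  ∑-+ (suc m) f g = trans (cong (f 0 + g 0 +_) (∑-+ m (f ∘ suc) (g ∘ suc))) (interchange (f 0) (g 0) _ _)
    where
    interchange : ∀ a b c d → a + b + (c + d) ≡ a + c + (b + d)
    interchange = solve-∀

  ∑-split : ∀ m n (f : ℕ → ℕ) → ∑< (m + n) f ≡ ∑< m f + ∑[ i < n ] f (m + i)
  ∑-split zero    n f = refl
  ∑-split (suc m) n f = trans (cong (f 0 +_) (∑-split m n (f ∘ suc))) (sym (+-assoc (f 0) _ _))

  ∑-prefix-≤ : ∀ {m n} (f : ℕ → ℕ) → m ≤ n → ∑< m f ≤ ∑< n f
  ∑-prefix-≤ f z≤n       = z≤n
  ∑-prefix-≤ f (s≤s m≤n) = +-monoʳ-≤ (f 0) (∑-prefix-≤ (f ∘ suc) m≤n)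

  ∑-window-≤ : ∀ {k d} m (f : ℕ → ℕ) → k ≤ d → ∑[ i < m ] f (k + i) ≤ ∑< (d + m) f
  ∑-window-≤ {k} {d} m f k≤d = begin
    ∑[ i < m ] f (k + i)             ≤⟨ m≤n+m _ _ ⟩
    ∑< k f + ∑[ i < m ] f (k + i)    ≡⟨ ∑-split k m f ⟨
    ∑< (k + m) f                     ≤⟨ ∑-prefix-≤ f (+-monoˡ-≤ m k≤d) ⟩
    ∑< (d + m) f                     ∎
    where open ≤-Reasoning

  ∑-periodic : ∀ p q r (f : ℕ → ℕ) → (∀ i → f (p + i) ≡ f i) →
               ∑< (q * p + r) f ≡ q * ∑< p f + ∑< r f
  ∑-periodic p zero    r f periodic = refl
  ∑-periodic p (suc q) r f periodic = begin
    ∑< (p + q * p + r) f                     ≡⟨ cong (λ m → ∑< m f) (+-assoc p (q * p) r) ⟩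
    ∑< (p + (q * p + r)) f                   ≡⟨ ∑-split p (q * p + r) f ⟩
    ∑< p f + ∑[ i < q * p + r ] f (p + i)    ≡⟨ cong (∑< p f +_) (∑-cong (q * p + r) periodic) ⟩
    ∑< p f + ∑< (q * p + r) f                ≡⟨ cong (∑< p f +_) (∑-periodic p q r f periodic) ⟩
    ∑< p f + (q * ∑< p f + ∑< r f)           ≡⟨ +-assoc (∑< p f) (q * ∑< p f) (∑< r f) ⟨
    suc q * ∑< p f + ∑< r f                  ∎
    where open ≡-Reasoning

  ∑-periodic-≤ : ∀ p .{{_ : NonZero p}} m (f : ℕ → ℕ) → (∀ i → f (p + i) ≡ f i) →
                 p * ∑< m f ≤ ∑< p f * (m + p)
  ∑-periodic-≤ p m f periodic = begin
    p * ∑< m f              ≡⟨ cong (λ n → p * ∑< n f) (trans (m≡m%n+[m/n]*n m p) (+-comm r (q * p))) ⟩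
    p * ∑< (q * p + r) f    ≡⟨ cong (p *_) (∑-periodic p q r f periodic) ⟩
    p * (q * S + ∑< r f)    ≤⟨ *-monoʳ-≤ p (+-monoʳ-≤ (q * S) (∑-prefix-≤ f (<⇒≤ (m%n<n m p)))) ⟩
    p * (q * S + S)         ≡⟨ regroup p q S ⟩
    S * (q * p + p)         ≤⟨ *-monoʳ-≤ S (+-monoˡ-≤ p (m/n*n≤m m p)) ⟩
    S * (m + p)             ∎
    where
    open ≤-Reasoning
    q = m / p
    r = m % p
    S = ∑< p f
    regroup : ∀ p q S → p * (q * S + S) ≡ S * (q * p + p)
    regroup = solve-∀

  indicator : Bool → ℕ
  indicator true  = 1
  indicator false = 0

  length-filter-T? : ∀ {A : Set} (b : A → Bool) xs → length (filter (T? ∘ b) xs) ≡ sum (map (indicator ∘ b) xs)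
  length-filter-T? b []       = refl
  length-filter-T? b (x ∷ xs) with b x
  ... | true  = cong suc (length-filter-T? b xs)
  ... | false = length-filter-T? b xs

  ∈-length≡1 : ∀ {A : Set} {xs : List A} {x y} → length xs ≡ 1 → x ∈ xs → y ∈ xs → x ≡ y
  ∈-length≡1 {xs = _ ∷ []} _ (here refl) (here refl) = refl

  ∈⇒1≤length : ∀ {A : Set} {xs : List A} {x} → x ∈ xs → 1 ≤ length xs
  ∈⇒1≤length {xs = _ ∷ _} _ = s≤s z≤n

  sum-map-∘ : ∀ {A B : Set} (f : B → ℕ) (g : A → B) xs → sum (map f (map g xs)) ≡ sum (map (f ∘ g) xs)
  sum-map-∘ f g xs = cong sum (sym (map-∘ xs))

  sum-map-*ˡ : ∀ {A : Set} k (f : A → ℕ) xs → sum (map (λ x → k * f x) xs) ≡ k * sum (map f xs)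
  sum-map-*ˡ k f []       = sym (*-zeroʳ k)
  sum-map-*ˡ k f (x ∷ xs) = trans (cong (k * f x +_) (sum-map-*ˡ k f xs)) (sym (*-distribˡ-+ k (f x) _))

  sum-map-mono-≤ : ∀ {A : Set} (xs : List A) {f g : A → ℕ} → (∀ {x} → x ∈ xs → f x ≤ g x) →
                   sum (map f xs) ≤ sum (map g xs)
  sum-map-mono-≤ []       f≤g = z≤n
  sum-map-mono-≤ (x ∷ xs) f≤g = +-mono-≤ (f≤g (here refl)) (sum-map-mono-≤ xs (f≤g ∘ there))

  sum-map-concatMap : ∀ {A B : Set} (f : B → ℕ) (g : A → List B) xs →
                      sum (map f (concatMap g xs)) ≡ sum (map (λ x → sum (map f (g x))) xs)
  sum-map-concatMap f g []       = refl
  sum-map-concatMap f g (x ∷ xs) = begin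
    sum (map f (g x ++ concatMap g xs))                          ≡⟨ cong sum (map-++ f (g x) _) ⟩
    sum (map f (g x) ++ map f (concatMap g xs))                  ≡⟨ sum-++ (map f (g x)) _ ⟩
    sum (map f (g x)) + sum (map f (concatMap g xs))             ≡⟨ cong (sum (map f (g x)) +_) (sum-map-concatMap f g xs) ⟩
    sum (map f (g x)) + sum (map (λ x → sum (map f (g x))) xs)   ∎
    where open ≡-Reasoning

  sum-map-applyUpTo : ∀ {A : Set} (f : A → ℕ) (g : ℕ → A) m → sum (map f (applyUpTo g m)) ≡ ∑[ i < m ] f (g i)
  sum-map-applyUpTo f g zero    = refl
  sum-map-applyUpTo f g (suc m) = cong (f (g 0) +_) (sum-map-applyUpTo f (g ∘ suc) m)

  ∑-sum-comm : ∀ {A : Set} m (xs : List A) (f : ℕ → A → ℕ) →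
               ∑[ i < m ] sum (map (f i) xs) ≡ sum (map (λ x → ∑[ i < m ] f i x) xs)
  ∑-sum-comm m []       f = trans (∑-const m 0) (*-zeroʳ m)
  ∑-sum-comm m (x ∷ xs) f = trans (∑-+ m (λ i → f i x) _) (cong (∑[ i < m ] f i x +_) (∑-sum-comm m xs f))

module Geometry where

  open Sums
  open import Data.Nat as ℕ using (ℕ; suc; _+_; _*_; _≤_; z≤n; s≤s)
  open import Data.Nat.Properties as ℕ using (≤-refl; module ≤-Reasoning)
  open import Data.Nat.ListAction using (sum)
  open import Data.Integer as ℤ using (ℤ; +_; 0ℤ; 1ℤ; -1ℤ)
  open import Data.Integer.Properties as ℤ using ()
  open import Data.Integer.Tactic.RingSolver using (solve-∀)
  open import Data.List using (List; []; _∷_; map; upTo)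
  open import Data.List.Membership.Propositional using (_∈_)
  open import Data.List.Membership.Propositional.Properties using (∈-map⁺; ∈-map⁻)
  open import Data.List.Relation.Unary.Any using (here; there)
  open import Data.Product using (_×_; _,_; ∃-syntax)
  open import Data.Product.Properties using (≡-dec)
  open import Data.Sum using (inj₁; inj₂)
  open import Function using (_∘_; _⇔_; mk⇔; Equivalence)
  open import Relation.Binary.Definitions using (DecidableEquality)
  open import Relation.Binary.PropositionalEquality
  open import Relation.Nullary using (¬_)
  open import Relation.Nullary.Decidable using (from-no)

  infixl 6 _⊕_ _⊖_

  _⊕_ _⊖_ : Vertex → Vertex → Vertex
  (a , b) ⊕ (c , d) = (a ℤ.+ c , b ℤ.+ d)
  (a , b) ⊖ (c , d) = (a ℤ.- c , b ℤ.- d)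

  0v : Vertex
  0v = (0ℤ , 0ℤ)

  _≟ᵥ_ : DecidableEquality Vertex
  _≟ᵥ_ = ≡-dec ℤ._≟_ ℤ._≟_

  ⊕-identityʳ : ∀ u → u ⊕ 0v ≡ u
  ⊕-identityʳ (a , b) = cong₂ _,_ (ℤ.+-identityʳ a) (ℤ.+-identityʳ b)

  ⊖-identityʳ : ∀ u → u ⊖ 0v ≡ u
  ⊖-identityʳ (a , b) = cong₂ _,_ (ℤ.+-identityʳ a) (ℤ.+-identityʳ b)

  ⊖-self : ∀ u → u ⊖ u ≡ 0v
  ⊖-self (a , b) = cong₂ _,_ (ℤ.+-inverseʳ a) (ℤ.+-inverseʳ b)

  ⊖-⊖-cancel : ∀ u w → u ⊖ (u ⊖ w) ≡ w
  ⊖-⊖-cancel (a , b) (c , d) = cong₂ _,_ (cancel a c) (cancel b d)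
    where
    cancel : ∀ x y → x ℤ.- (x ℤ.- y) ≡ y
    cancel = solve-∀

  ⊖-⊕-cancel : ∀ u δ → (u ⊖ δ) ⊕ δ ≡ u
  ⊖-⊕-cancel (a , b) (c , d) = cong₂ _,_ (cancel a c) (cancel b d)
    where
    cancel : ∀ x y → (x ℤ.- y) ℤ.+ y ≡ x
    cancel = solve-∀

  ⊕-⊖-⊕ : ∀ c a b → (c ⊕ a) ⊖ (c ⊕ b) ≡ a ⊖ b
  ⊕-⊖-⊕ (x , y) (a₁ , a₂) (b₁ , b₂) = cong₂ _,_ (cancel x a₁ b₁) (cancel y a₂ b₂)
    where
    cancel : ∀ x a b → (x ℤ.+ a) ℤ.- (x ℤ.+ b) ≡ a ℤ.- b
    cancel = solve-∀

  ⊖-⊖-⊖ : ∀ u δ ε → (u ⊖ δ) ⊖ (u ⊖ ε) ≡ ε ⊖ δ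
  ⊖-⊖-⊖ (x , y) (a , b) (c , d) = cong₂ _,_ (cancel x a c) (cancel y b d)
    where
    cancel : ∀ x a c → (x ℤ.- a) ℤ.- (x ℤ.- c) ≡ c ℤ.- a
    cancel = solve-∀

  ⊖-⊖-neg : ∀ u δ → (u ⊖ δ) ⊖ (0v ⊖ δ) ≡ u
  ⊖-⊖-neg (x , y) (a , b) = cong₂ _,_ (cancel x a) (cancel y b)
    where
    cancel : ∀ x a → (x ℤ.- a) ℤ.- (0ℤ ℤ.- a) ≡ x
    cancel = solve-∀

  -- In cyclic order around the origin, so consecutive steps are adjacent.
  unitSteps Δ : List Vertex
  unitSteps = (1ℤ , 0ℤ) ∷ (1ℤ , 1ℤ) ∷ (0ℤ , 1ℤ) ∷ (-1ℤ , 0ℤ) ∷ (-1ℤ , -1ℤ) ∷ (0ℤ , -1ℤ) ∷ []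
  Δ = 0v ∷ unitSteps

  open import Data.List.Membership.DecPropositional _≟ᵥ_ public using (_∈?_)

  Adj⇔⊖∈unitSteps : ∀ u w → Adj u w ⇔ (u ⊖ w) ∈ unitSteps
  Adj⇔⊖∈unitSteps u w = mk⇔ to from
    where
    to : Adj u w → (u ⊖ w) ∈ unitSteps
    to (inj₁ e)                              = here e
    to (inj₂ (inj₁ e))                       = there (there (there (here e)))
    to (inj₂ (inj₂ (inj₁ e)))                = there (there (here e))
    to (inj₂ (inj₂ (inj₂ (inj₁ e))))         = there (there (there (there (there (here e)))))
    to (inj₂ (inj₂ (inj₂ (inj₂ (inj₁ e)))))  = there (here e)
    to (inj₂ (inj₂ (inj₂ (inj₂ (inj₂ e)))))  = there (there (there (there (here e))))
    from : (u ⊖ w) ∈ unitSteps → Adj u w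
    from (here e)                                          = inj₁ e
    from (there (here e))                                  = inj₂ (inj₂ (inj₂ (inj₂ (inj₁ e))))
    from (there (there (here e)))                          = inj₂ (inj₂ (inj₁ e))
    from (there (there (there (here e))))                  = inj₂ (inj₁ e)
    from (there (there (there (there (here e)))))          = inj₂ (inj₂ (inj₂ (inj₂ (inj₂ e))))
    from (there (there (there (there (there (here e)))))) = inj₂ (inj₂ (inj₂ (inj₁ e)))

  InN⇔⊖∈Δ : ∀ u w → InN u w ⇔ (u ⊖ w) ∈ Δ
  InN⇔⊖∈Δ u w = mk⇔ to from
    where
    to : InN u w → (u ⊖ w) ∈ Δ
    to (inj₁ refl) = here (⊖-self u)
    to (inj₂ adj)  = there (Equivalence.to (Adj⇔⊖∈unitSteps u w) adj)
    from : (u ⊖ w) ∈ Δ → InN u w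
    from (here u⊖w≡0v) = inj₁ (begin
      w             ≡⟨ ⊖-⊖-cancel u w ⟨
      u ⊖ (u ⊖ w)   ≡⟨ cong (u ⊖_) u⊖w≡0v ⟩
      u ⊖ 0v        ≡⟨ ⊖-identityʳ u ⟩
      u             ∎)
      where open ≡-Reasoning
    from (there p)     = inj₂ (Equivalence.from (Adj⇔⊖∈unitSteps u w) p)

  InN-⊖ : ∀ u {δ} → δ ∈ Δ → InN u (u ⊖ δ)
  InN-⊖ u {δ} δ∈Δ = Equivalence.from (InN⇔⊖∈Δ u (u ⊖ δ)) (subst (_∈ Δ) (sym (⊖-⊖-cancel u δ)) δ∈Δ)

  N[_] : Vertex → List Vertex
  N[ u ] = map (u ⊖_) Δ

  ∈N⇔InN : ∀ u w → w ∈ N[ u ] ⇔ InN u w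
  ∈N⇔InN u w = mk⇔ to from
    where
    to : w ∈ N[ u ] → InN u w
    to w∈N with ∈-map⁻ (u ⊖_) w∈N
    ... | δ , δ∈Δ , refl = InN-⊖ u δ∈Δ
    from : InN u w → w ∈ N[ u ]
    from uw = subst (_∈ N[ u ]) (⊖-⊖-cancel u w) (∈-map⁺ (u ⊖_) (Equivalence.to (InN⇔⊖∈Δ u w) uw))

  Adj-irrefl : ∀ u → ¬ Adj u u
  Adj-irrefl u adj =
    from-no (0v ∈? unitSteps) (subst (_∈ unitSteps) (⊖-self u) (Equivalence.to (Adj⇔⊖∈unitSteps u u) adj))

  Adj-translate : ∀ c a b → (a ⊖ b) ∈ unitSteps → Adj (c ⊕ a) (c ⊕ b)
  Adj-translate c a b a⊖b∈ =
    Equivalence.from (Adj⇔⊖∈unitSteps (c ⊕ a) (c ⊕ b)) (subst (_∈ unitSteps) (sym (⊕-⊖-⊕ c a b)) a⊖b∈)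

  side : ℕ → ℕ
  side n = suc (2 * n)

  side-suc : ∀ n → side (suc n) ≡ 2 + side n
  side-suc n = cong suc (ℕ.*-suc 2 n)

  coord : ℕ → ℕ → ℤ
  coord n i = + i ℤ.- + n

  ∑Q : ℕ → (Vertex → ℕ) → ℕ
  ∑Q n f = ∑[ i < side n ] ∑[ j < side n ] f (coord n i , coord n j)

  countIn≡∑Q : ∀ C n → countIn C n ≡ ∑Q n (indicator ∘ C)
  countIn≡∑Q C n = begin
    countIn C n                                           ≡⟨ length-filter-T? C (box n) ⟩
    sum (map χ (box n))                                   ≡⟨ sum-map-concatMap χ row (interval n) ⟩
    sum (map (λ x → sum (map χ (row x))) (interval n))    ≡⟨ sum-over-interval (λ x → sum (map χ (row x))) ⟩
    ∑[ i < side n ] sum (map χ (row (coord n i)))         ≡⟨ ∑-cong (side n) rows ⟩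
    ∑Q n χ                                                ∎
    where
    open ≡-Reasoning
    χ = indicator ∘ C
    row : ℤ → List Vertex
    row x = map (x ,_) (interval n)
    sum-over-interval : (f : ℤ → ℕ) → sum (map f (interval n)) ≡ ∑[ i < side n ] f (coord n i)
    sum-over-interval f = trans (sum-map-∘ f (coord n) (upTo (side n))) (sum-map-applyUpTo (f ∘ coord n) (λ i → i) (side n))
    rows : ∀ i → sum (map χ (row (coord n i))) ≡ ∑[ j < side n ] χ (coord n i , coord n j)
    rows i = trans (sum-map-∘ χ (coord n i ,_) (interval n)) (sum-over-interval (λ y → χ (coord n i , y)))

  ∑Q-cong : ∀ n {f g : Vertex → ℕ} → (∀ u → f u ≡ g u) → ∑Q n f ≡ ∑Q n g
  ∑Q-cong n f≗g = ∑-cong (side n) (λ i → ∑-cong (side n) (λ j → f≗g (coord n i , coord n j)))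

  ∑Q-mono-≤ : ∀ n {f g : Vertex → ℕ} → (∀ u → f u ≤ g u) → ∑Q n f ≤ ∑Q n g
  ∑Q-mono-≤ n f≤g = ∑-mono-≤ (side n) (λ i → ∑-mono-≤ (side n) (λ j → f≤g (coord n i , coord n j)))

  ∑Q-const : ∀ n k → ∑Q n (λ _ → k) ≡ sizeQ n * k
  ∑Q-const n k = begin
    ∑[ i < side n ] ∑[ j < side n ] k   ≡⟨ ∑-cong (side n) (λ _ → ∑-const (side n) k) ⟩
    ∑[ i < side n ] (side n * k)        ≡⟨ ∑-const (side n) (side n * k) ⟩
    side n * (side n * k)               ≡⟨ ℕ.*-assoc (side n) (side n) k ⟨
    sizeQ n * k                         ∎
    where open ≡-Reasoning

  ∑Q-*ˡ : ∀ n k (f : Vertex → ℕ) → ∑Q n (λ u → k * f u) ≡ k * ∑Q n f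
  ∑Q-*ˡ n k f = trans (∑-cong (side n) (λ i → ∑-*ˡ (side n) k (λ j → f (coord n i , coord n j))))
                      (∑-*ˡ (side n) k (λ i → ∑[ j < side n ] f (coord n i , coord n j)))

  ∑Q-sum-comm : ∀ {A : Set} n (xs : List A) (f : Vertex → A → ℕ) →
                ∑Q n (λ u → sum (map (f u) xs)) ≡ sum (map (λ x → ∑Q n (λ u → f u x)) xs)
  ∑Q-sum-comm n xs f = trans (∑-cong (side n) (λ i → ∑-sum-comm (side n) xs (λ j → f (coord n i , coord n j))))
                             (∑-sum-comm (side n) xs (λ i x → ∑[ j < side n ] f (coord n i , coord n j) x))

  Δ-bounded : ∀ {δ} → δ ∈ Δ → ∃[ k ] ∃[ l ] k ≤ 2 × l ≤ 2 × δ ≡ (1ℤ ℤ.- + k , 1ℤ ℤ.- + l)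
  Δ-bounded (here refl)                                                 = 1 , 1 , s≤s z≤n , s≤s z≤n , refl
  Δ-bounded (there (here refl))                                         = 0 , 1 , z≤n , s≤s z≤n , refl
  Δ-bounded (there (there (here refl)))                                 = 0 , 0 , z≤n , z≤n , refl
  Δ-bounded (there (there (there (here refl))))                         = 1 , 0 , s≤s z≤n , z≤n , refl
  Δ-bounded (there (there (there (there (here refl)))))                 = 2 , 1 , ≤-refl , s≤s z≤n , refl
  Δ-bounded (there (there (there (there (there (here refl))))))         = 2 , 2 , ≤-refl , ≤-refl , refl
  Δ-bounded (there (there (there (there (there (there (here refl))))))) = 1 , 2 , s≤s z≤n , ≤-refl , refl

  coord-translate : ∀ n i k → coord n i ℤ.- (1ℤ ℤ.- + k) ≡ coord (suc n) (k + i)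
  coord-translate n i k = shift (+ i) (+ n) (+ k)
    where
    shift : ∀ i n k → (i ℤ.- n) ℤ.- (1ℤ ℤ.- k) ≡ (k ℤ.+ i) ℤ.- (1ℤ ℤ.+ n)
    shift = solve-∀

  ∑Q-translate-≤ : ∀ n (f : Vertex → ℕ) {δ} → δ ∈ Δ → ∑Q n (λ u → f (u ⊖ δ)) ≤ ∑Q (suc n) f
  ∑Q-translate-≤ n f δ∈Δ with Δ-bounded δ∈Δ
  ... | k , l , k≤2 , l≤2 , refl = begin
    ∑[ i < M ] ∑[ j < M ] f ((coord n i , coord n j) ⊖ (1ℤ ℤ.- + k , 1ℤ ℤ.- + l))
      ≡⟨ ∑-cong M (λ i → ∑-cong M (λ j → cong f (cong₂ _,_ (coord-translate n i k) (coord-translate n j l)))) ⟩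
    ∑[ i < M ] ∑[ j < M ] g (k + i) (l + j)
      ≤⟨ ∑-mono-≤ M (λ i → ∑-window-≤ M (g (k + i)) l≤2) ⟩
    ∑[ i < M ] ∑[ j < 2 + M ] g (k + i) j
      ≤⟨ ∑-window-≤ M (λ i → ∑[ j < 2 + M ] g i j) k≤2 ⟩
    ∑[ i < 2 + M ] ∑[ j < 2 + M ] g i j
      ≡⟨ cong (λ m → ∑[ i < m ] ∑[ j < m ] g i j) (side-suc n) ⟨
    ∑Q (suc n) f
      ∎
    where
    open ≤-Reasoning
    M = side n
    g : ℕ → ℕ → ℕ
    g i j = f (coord (suc n) i , coord (suc n) j)

module Discharging (C : Code) where

  open Sums
  open Geometry
  open import Data.Nat using (ℕ; suc; _+_; _*_; _≤_; z≤n; s≤s)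
  open import Data.Nat.Properties using (≤-refl; ≤-trans; ≤-reflexive; +-mono-≤; +-identityʳ; *-comm; module ≤-Reasoning)
  open import Data.Nat.Tactic.RingSolver using (solve-∀)
  open import Data.Nat.ListAction using (sum)
  open import Data.Integer using (0ℤ; 1ℤ; -1ℤ)
  open import Data.Bool using (true; false)
  open import Data.Bool.Properties using (T?; T-≡)
  open import Data.List using (List; map; filter; length)
  open import Data.List.Properties using (map-cong)
  open import Data.List.Membership.Propositional using (_∈_)
  open import Data.List.Membership.Propositional.Properties using (∈-filter⁺; ∈-filter⁻)
  open import Data.Product using (_,_; proj₁)
  open import Data.Sum using (inj₁; inj₂)
  open import Data.Empty using (⊥; ⊥-elim)
  open import Function using (_∘_; _⇔_; mk⇔; Equivalence)
  open import Relation.Binary.PropositionalEquality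
  open import Relation.Nullary using (¬_)
  open import Relation.Nullary.Decidable using (True; toWitness)

  share : ℕ → ℕ
  share 1 = 2
  share _ = 1

  share≤2 : ∀ k → share k ≤ 2
  share≤2 0             = s≤s z≤n
  share≤2 1             = ≤-refl
  share≤2 (suc (suc k)) = s≤s z≤n

  2≤k*share : ∀ k → 1 ≤ k → 2 ≤ k * share k
  2≤k*share 1             _ = ≤-refl
  2≤k*share (suc (suc k)) _ = s≤s (s≤s z≤n)

  share-pair-≤ : ∀ k k′ → (k ≡ 1 → k′ ≡ 1 → ⊥) → share k + share k′ ≤ 3
  share-pair-≤ 0             k′            _        = s≤s (share≤2 k′)
  share-pair-≤ 1             0             _        = ≤-refl
  share-pair-≤ 1             1             not-both = ⊥-elim (not-both refl refl)
  share-pair-≤ 1             (suc (suc _)) _        = ≤-refl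
  share-pair-≤ (suc (suc _)) k′            _        = s≤s (share≤2 k′)

  I : Vertex → List Vertex
  I u = filter (T? ∘ C) N[ u ]

  ∈I⇔InI : ∀ u w → w ∈ I u ⇔ InI C u w
  ∈I⇔InI u w = mk⇔ to from
    where
    to : w ∈ I u → InI C u w
    to w∈I with ∈-filter⁻ (T? ∘ C) w∈I
    ... | w∈N , Cw = Equivalence.to (∈N⇔InN u w) w∈N , Equivalence.to T-≡ Cw
    from : InI C u w → w ∈ I u
    from (uw , Cw) = ∈-filter⁺ (T? ∘ C) (Equivalence.from (∈N⇔InN u w) uw) (Equivalence.from T-≡ Cw)

  ∣I∣ : Vertex → ℕ
  ∣I∣ u = length (I u)

  ∣I∣≡sum : ∀ u → ∣I∣ u ≡ sum (map (λ δ → indicator (C (u ⊖ δ))) Δ)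
  ∣I∣≡sum u = trans (length-filter-T? C N[ u ]) (sum-map-∘ (indicator ∘ C) (u ⊖_) Δ)

  InI-unique : ∀ {u w w′} → ∣I∣ u ≡ 1 → InI C u w → InI C u w′ → w ≡ w′
  InI-unique {u} {w} {w′} ∣Iu∣≡1 uw uw′ =
    ∈-length≡1 ∣Iu∣≡1 (Equivalence.from (∈I⇔InI u w) uw) (Equivalence.from (∈I⇔InI u w′) uw′)

  covering⇒2≤weight : IsCovering C → ∀ u → 2 ≤ ∣I∣ u * share (∣I∣ u)
  covering⇒2≤weight covering u with covering u
  ... | w , uw = 2≤k*share (∣I∣ u) (∈⇒1≤length (Equivalence.from (∈I⇔InI u w) uw))

  private-neighbours-nonadjacent : IsLocalLD C → ∀ c v v′ → c ∈C C → Adj v c → Adj v′ c → Adj v v′ →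
                                   ∣I∣ v ≡ 1 → ∣I∣ v′ ≡ 1 → ⊥
  private-neighbours-nonadjacent (_ , locating) c v v′ Cc vc v′c vv′ ∣Iv∣≡1 ∣Iv′∣≡1 =
    locating v v′ vv′ (∉C vc ∣Iv∣≡1) (∉C v′c ∣Iv′∣≡1) same
    where
    ∉C : ∀ {x} → Adj x c → ∣I∣ x ≡ 1 → ¬ (x ∈C C)
    ∉C {x} xc ∣Ix∣≡1 Cx with InI-unique ∣Ix∣≡1 (inj₁ refl , Cx) (inj₂ xc , Cc)
    ... | refl = Adj-irrefl x xc
    same : SameI C v v′
    same w = move ∣Iv∣≡1 vc v′c , move ∣Iv′∣≡1 v′c vc
      where
      move : ∀ {x y} → ∣I∣ x ≡ 1 → Adj x c → Adj y c → InI C x w → InI C y w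
      move ∣Ix∣≡1 xc yc xw with InI-unique ∣Ix∣≡1 xw (inj₂ xc , Cc)
      ... | refl = inj₂ yc , Cc

  received : Vertex → ℕ
  received c = sum (map (λ δ → share (∣I∣ (c ⊕ δ))) Δ)

  received≤11 : IsLocalLD C → ∀ {c} → c ∈C C → received c ≤ 11
  received≤11 lld {c} Cc = begin
    received c
      ≡⟨ regroup (s 0v) (s (1ℤ , 0ℤ)) (s (1ℤ , 1ℤ)) (s (0ℤ , 1ℤ)) (s (-1ℤ , 0ℤ)) (s (-1ℤ , -1ℤ)) (s (0ℤ , -1ℤ)) ⟩
    s 0v + ((s (1ℤ , 0ℤ) + s (1ℤ , 1ℤ)) + ((s (0ℤ , 1ℤ) + s (-1ℤ , 0ℤ)) + (s (-1ℤ , -1ℤ) + s (0ℤ , -1ℤ))))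
      ≤⟨ +-mono-≤ (share≤2 (∣I∣ (c ⊕ 0v))) (+-mono-≤ (pair-≤ (1ℤ , 0ℤ) (1ℤ , 1ℤ))
                 (+-mono-≤ (pair-≤ (0ℤ , 1ℤ) (-1ℤ , 0ℤ)) (pair-≤ (-1ℤ , -1ℤ) (0ℤ , -1ℤ)))) ⟩
    11
      ∎
    where
    open ≤-Reasoning
    s : Vertex → ℕ
    s δ = share (∣I∣ (c ⊕ δ))
    regroup : ∀ a b₁ b₂ d₁ d₂ e₁ e₂ →
              a + (b₁ + (b₂ + (d₁ + (d₂ + (e₁ + (e₂ + 0)))))) ≡ a + ((b₁ + b₂) + ((d₁ + d₂) + (e₁ + e₂)))
    regroup = solve-∀
    neighbour : ∀ {δ} → δ ∈ unitSteps → Adj (c ⊕ δ) c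
    neighbour {δ} δ∈ =
      subst (Adj (c ⊕ δ)) (⊕-identityʳ c) (Adj-translate c δ 0v (subst (_∈ unitSteps) (sym (⊖-identityʳ δ)) δ∈))
    pair-≤ : ∀ δ δ′ {_ : True (δ ∈? unitSteps)} {_ : True (δ′ ∈? unitSteps)} {_ : True ((δ ⊖ δ′) ∈? unitSteps)} →
             s δ + s δ′ ≤ 3
    pair-≤ δ δ′ {δ∈} {δ′∈} {δ⊖δ′∈} = share-pair-≤ (∣I∣ (c ⊕ δ)) (∣I∣ (c ⊕ δ′))
      (private-neighbours-nonadjacent lld c (c ⊕ δ) (c ⊕ δ′) Cc (neighbour (toWitness δ∈)) (neighbour (toWitness δ′∈))
                                      (Adj-translate c δ δ′ (toWitness δ⊖δ′∈)))

  sent : Vertex → Vertex → ℕ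
  sent δ c = indicator (C c) * share (∣I∣ (c ⊕ δ))

  weight≡sum-sent : ∀ u → ∣I∣ u * share (∣I∣ u) ≡ sum (map (λ δ → sent δ (u ⊖ δ)) Δ)
  weight≡sum-sent u = begin
    ∣I∣ u * s                                        ≡⟨ cong (_* s) (∣I∣≡sum u) ⟩
    sum (map (λ δ → indicator (C (u ⊖ δ))) Δ) * s    ≡⟨ *-comm _ s ⟩
    s * sum (map (λ δ → indicator (C (u ⊖ δ))) Δ)    ≡⟨ sum-map-*ˡ s (λ δ → indicator (C (u ⊖ δ))) Δ ⟨
    sum (map (λ δ → s * indicator (C (u ⊖ δ))) Δ)    ≡⟨ cong sum (map-cong sent-back Δ) ⟩
    sum (map (λ δ → sent δ (u ⊖ δ)) Δ)               ∎
    where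
    open ≡-Reasoning
    s = share (∣I∣ u)
    sent-back : ∀ δ → s * indicator (C (u ⊖ δ)) ≡ sent δ (u ⊖ δ)
    sent-back δ = trans (*-comm s _) (cong (λ x → indicator (C (u ⊖ δ)) * share (∣I∣ x)) (sym (⊖-⊕-cancel u δ)))

  received-≤ : IsLocalLD C → ∀ c → indicator (C c) * received c ≤ 11 * indicator (C c)
  received-≤ lld c with C c in Cc
  ... | true  = ≤-trans (≤-reflexive (+-identityʳ (received c))) (received≤11 lld Cc)
  ... | false = z≤n

  discharging : IsLocalLD C → ∀ n → 2 * sizeQ n ≤ 11 * countIn C (suc n)
  discharging lld n = begin
    2 * sizeQ n                                       ≡⟨ trans (*-comm 2 (sizeQ n)) (sym (∑Q-const n 2)) ⟩
    ∑Q n (λ _ → 2)                                    ≤⟨ ∑Q-mono-≤ n (covering⇒2≤weight (proj₁ lld)) ⟩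
    ∑Q n (λ u → ∣I∣ u * share (∣I∣ u))                ≡⟨ ∑Q-cong n weight≡sum-sent ⟩
    ∑Q n (λ u → sum (map (λ δ → sent δ (u ⊖ δ)) Δ))   ≡⟨ ∑Q-sum-comm n Δ (λ u δ → sent δ (u ⊖ δ)) ⟩
    sum (map (λ δ → ∑Q n (λ u → sent δ (u ⊖ δ))) Δ)   ≤⟨ sum-map-mono-≤ Δ (λ {δ} δ∈Δ → ∑Q-translate-≤ n (sent δ) δ∈Δ) ⟩
    sum (map (λ δ → ∑Q (suc n) (sent δ)) Δ)           ≡⟨ ∑Q-sum-comm (suc n) Δ (λ c δ → sent δ c) ⟨
    ∑Q (suc n) (λ c → sum (map (λ δ → sent δ c) Δ))   ≡⟨ ∑Q-cong (suc n) (λ c → sum-map-*ˡ (indicator (C c)) (λ δ → share (∣I∣ (c ⊕ δ))) Δ) ⟩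
    ∑Q (suc n) (λ c → indicator (C c) * received c)  ≤⟨ ∑Q-mono-≤ (suc n) (received-≤ lld) ⟩
    ∑Q (suc n) (λ c → 11 * indicator (C c))          ≡⟨ ∑Q-*ˡ (suc n) 11 (indicator ∘ C) ⟩
    11 * ∑Q (suc n) (indicator ∘ C)                   ≡⟨ cong (11 *_) (countIn≡∑Q C (suc n)) ⟨
    11 * countIn C (suc n)                            ∎
    where open ≤-Reasoning

module Density where

  open Geometry using (side; side-suc)
  open import Data.Nat using (suc; _+_; _*_; _≤_; _≥_)
  open import Data.Nat.Properties
    using (≤-trans; +-mono-≤; +-monoʳ-≤; *-monoˡ-≤; *-mono-≤; *-distribʳ-+; m≤m+n; m≤n+m; m≤n*m; n≤1+n; module ≤-Reasoning)
  open import Data.Nat.Coprimality using (Coprime)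
  open import Data.Nat.Tactic.RingSolver using (solve-∀)
  open import Data.Integer as ℤ using (+_)
  open import Data.Integer.Properties as ℤ using (pos-*; pos-+)
  open import Data.Rational as ℚ using (ℚ; mkℚ; _/_; toℚᵘ; Positive)
  open import Data.Rational.Properties as ℚ using ()
  open import Data.Rational.Unnormalised as ℚᵘ using (mkℚᵘ)
  open import Data.Rational.Unnormalised.Properties as ℚᵘ using ()
  open import Data.Product using (_,_; map₂)
  open import Relation.Binary.PropositionalEquality

  /-≤-/+ : ∀ a x b y c z .{coprime : Coprime c (suc z)} → a * (suc y * suc z) ≤ (b * suc z + c * suc y) * suc x →
           (+ a) / suc x ℚ.≤ (+ b) / suc y ℚ.+ mkℚ (+ c) z coprime
  /-≤-/+ a x b y c z {coprime} cross = ℚ.toℚᵘ-cancel-≤ (begin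
    toℚᵘ ((+ a) / suc x)                                   ≃⟨ ℚ.toℚᵘ-fromℚᵘ (mkℚᵘ (+ a) x) ⟩
    mkℚᵘ (+ a) x                                           ≤⟨ ℚᵘ.*≤* (subst₂ ℤ._≤_ (pos-* a (suc y * suc z)) (pos-* N (suc x)) (ℤ.+≤+ cross)) ⟩
    mkℚᵘ (+ N) (z + y * suc z)                             ≡⟨ cong (λ n → mkℚᵘ n (z + y * suc z)) numerator ⟩
    mkℚᵘ (+ b) y ℚᵘ.+ mkℚᵘ (+ c) z                         ≃⟨ ℚᵘ.+-congˡ (mkℚᵘ (+ c) z) (ℚᵘ.≃-sym (ℚ.toℚᵘ-fromℚᵘ (mkℚᵘ (+ b) y))) ⟩
    toℚᵘ ((+ b) / suc y) ℚᵘ.+ toℚᵘ (mkℚ (+ c) z coprime)   ≃⟨ ℚ.toℚᵘ-homo-+ ((+ b) / suc y) (mkℚ (+ c) z coprime) ⟨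
    toℚᵘ ((+ b) / suc y ℚ.+ mkℚ (+ c) z coprime)           ∎)
    where
    open ℚᵘ.≤-Reasoning
    N = b * suc z + c * suc y
    numerator : + N ≡ (+ b) ℤ.* (+ suc z) ℤ.+ (+ c) ℤ.* (+ suc y)
    numerator = trans (pos-+ (b * suc z) (c * suc y)) (cong₂ ℤ._+_ (pos-* b (suc z)) (pos-* c (suc y)))

  p≤q+r⇒p-r≤q : ∀ (p q r : ℚ) → p ℚ.≤ q ℚ.+ r → p ℚ.- r ℚ.≤ q
  p≤q+r⇒p-r≤q p q r p≤q+r = begin
    p ℚ.- r             ≤⟨ ℚ.+-monoˡ-≤ (ℚ.- r) p≤q+r ⟩
    q ℚ.+ r ℚ.- r       ≡⟨ ℚ.+-assoc q r (ℚ.- r) ⟩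
    q ℚ.+ (r ℚ.- r)     ≡⟨ cong (q ℚ.+_) (ℚ.+-inverseʳ r) ⟩
    q ℚ.+ ℚ.0ℚ          ≡⟨ ℚ.+-identityʳ q ⟩
    q                   ∎
    where open ℚ.≤-Reasoning

  p≤p+q : ∀ p q → .{{Positive q}} → p ℚ.≤ p ℚ.+ q
  p≤p+q p q = begin
    p                ≡⟨ ℚ.+-identityʳ p ⟨
    p ℚ.+ ℚ.0ℚ       ≤⟨ ℚ.+-monoʳ-≤ p (ℚ.nonNegative⁻¹ q {{ℚ.pos⇒nonNeg q}}) ⟩
    p ℚ.+ q          ∎
    where open ℚ.≤-Reasoning

  DensityAtMost-mono : ∀ {C x y} → x ℚ.≤ y → DensityAtMost C x → DensityAtMost C y
  DensityAtMost-mono x≤y atMost ε ε>0 =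
    map₂ (λ ratio≤x+ε n n≥N → ℚ.≤-trans (ratio≤x+ε n n≥N) (ℚ.+-monoˡ-≤ ε x≤y)) (atMost ε ε>0)

  densityAtLeast-from-box-bound : ∀ C p q → (∀ n → p * sizeQ n ≤ suc q * countIn C (suc n)) →
                                  DensityAtLeast C ((+ p) / suc q)
  densityAtLeast-from-box-bound C p q bound (mkℚ (+ suc a) b _) _ N =
    suc k , ≤-trans (m≤m+n N _) (n≤1+n k) , p≤q+r⇒p-r≤q _ _ _ (/-≤-/+ p q c _ (suc a) b cross)
    where
    k = N + 4 * p * suc b
    M = side k
    c = countIn C (suc k)
    4pb≤M : 4 * p * suc b ≤ M
    4pb≤M = ≤-trans (m≤n+m _ N) (≤-trans (m≤m+n k (k + 0)) (n≤1+n _))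
    sizeQ-suc : sizeQ (suc k) ≡ (2 + M) * (2 + M)
    sizeQ-suc = cong (λ m → m * m) (side-suc k)
    cross : p * (sizeQ (suc k) * suc b) ≤ (c * suc b + suc a * sizeQ (suc k)) * suc q
    cross = begin
      p * (sizeQ (suc k) * suc b)                             ≡⟨ cong (λ S → p * (S * suc b)) sizeQ-suc ⟩
      p * ((2 + M) * (2 + M) * suc b)                         ≡⟨ expand p M (suc b) ⟩
      p * (M * M) * suc b + 4 * p * suc b * suc M             ≤⟨ +-mono-≤ (*-monoˡ-≤ (suc b) (bound k)) (*-monoˡ-≤ (suc M) 4pb≤M) ⟩
      suc q * c * suc b + M * suc M                           ≤⟨ +-monoʳ-≤ (suc q * c * suc b) M*sucM≤ ⟩
      suc q * c * suc b + suc a * suc q * ((2 + M) * (2 + M)) ≡⟨ collect (suc q) c (suc b) (suc a) (2 + M) ⟩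
      (c * suc b + suc a * ((2 + M) * (2 + M))) * suc q       ≡⟨ cong (λ S → (c * suc b + suc a * S) * suc q) sizeQ-suc ⟨
      (c * suc b + suc a * sizeQ (suc k)) * suc q             ∎
      where
      open ≤-Reasoning
      M*sucM≤ : M * suc M ≤ suc a * suc q * ((2 + M) * (2 + M))
      M*sucM≤ = ≤-trans (*-mono-≤ (m≤n+m M 2) (n≤1+n (suc M))) (m≤n*m _ (suc a * suc q))
      expand : ∀ p M B → p * ((2 + M) * (2 + M) * B) ≡ p * (M * M) * B + 4 * p * B * suc M
      expand = solve-∀
      collect : ∀ Q c B A S → Q * c * B + A * Q * (S * S) ≡ (c * B + A * (S * S)) * Q
      collect = solve-∀

  densityAtMost-from-box-bound : ∀ C p q K → (∀ n → suc q * countIn C n ≤ side n * (p * side n + K)) →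
                                 DensityAtMost C ((+ p) / suc q)
  densityAtMost-from-box-bound C p q K bound (mkℚ (+ suc a) b _) _ =
    K * suc b , λ n n≥Kb → /-≤-/+ (countIn C n) _ p q (suc a) b (cross n n≥Kb)
    where
    cross : ∀ n → n ≥ K * suc b → countIn C n * (suc q * suc b) ≤ (p * suc b + suc a * suc q) * sizeQ n
    cross n n≥Kb = begin
      c * (suc q * suc b)                             ≡⟨ reorder c (suc q) (suc b) ⟩
      suc q * c * suc b                               ≤⟨ *-monoˡ-≤ (suc b) (bound n) ⟩
      M * (p * M + K) * suc b                         ≡⟨ expand M p K (suc b) ⟩
      p * suc b * (M * M) + K * suc b * M             ≤⟨ +-monoʳ-≤ (p * suc b * (M * M)) (*-monoˡ-≤ M Kb≤M) ⟩
      p * suc b * (M * M) + M * M                     ≤⟨ +-monoʳ-≤ (p * suc b * (M * M)) (m≤n*m (M * M) (suc a * suc q)) ⟩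
      p * suc b * (M * M) + suc a * suc q * (M * M)   ≡⟨ *-distribʳ-+ (M * M) (p * suc b) (suc a * suc q) ⟨
      (p * suc b + suc a * suc q) * (M * M)           ∎
      where
      open ≤-Reasoning
      c = countIn C n
      M = side n
      Kb≤M : K * suc b ≤ M
      Kb≤M = ≤-trans n≥Kb (≤-trans (m≤m+n n (n + 0)) (n≤1+n _))
      reorder : ∀ c Q B → c * (Q * B) ≡ Q * c * B
      reorder = solve-∀
      expand : ∀ M p K B → M * (p * M + K) * B ≡ p * B * (M * M) + K * B * M
      expand = solve-∀

module PeriodicCode where

  open Sums
  open Geometry
  open import Data.Nat as ℕ using (ℕ; zero; suc; _+_; _*_; _≤_)
  open import Data.Nat.Properties using (*-distribˡ-+; module ≤-Reasoning)
  open import Data.Nat.DivMod using (_mod_)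
  open import Data.Fin as Fin using (Fin; zero; suc; toℕ; #_)
  open import Data.Fin.Properties using (all?)
  open import Data.Integer as ℤ using (ℤ; +_; -[1+_])
  open import Data.Integer.Properties as ℤ using ()
  open import Data.Integer.Tactic.RingSolver using (solve-∀)
  open import Data.Bool using (Bool; true; false; T)
  open import Data.Bool.Properties using (T?; T-≡)
  open import Data.List.Membership.Propositional using (_∈_; find)
  open import Data.List.Relation.Unary.All as All using (All)
  open import Data.List.Relation.Unary.Any as Any using (Any)
  open import Data.Product using (_×_; _,_; proj₁; swap)
  open import Data.Sum using (_⊎_; inj₁; inj₂)
  open import Function using (_∘_; Equivalence)
  open import Relation.Binary.PropositionalEquality
  open import Relation.Nullary using (¬_; Dec)
  open import Relation.Nullary.Decidable using (from-yes; _×-dec_; _⊎-dec_; ¬?)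

  ℤ₉ : Set
  ℤ₉ = Fin 9

  infixl 6 _+₉_

  _+₉_ : ℤ₉ → ℤ₉ → ℤ₉
  i +₉ j = (toℕ i + toℕ j) mod 9

  +₉-identityˡ : ∀ i → # 0 +₉ i ≡ i
  +₉-identityˡ = from-yes (all? λ i → # 0 +₉ i Fin.≟ i)

  +₉-identityʳ : ∀ i → i +₉ # 0 ≡ i
  +₉-identityʳ = from-yes (all? λ i → i +₉ # 0 Fin.≟ i)

  +₉-comm : ∀ i j → i +₉ j ≡ j +₉ i
  +₉-comm = from-yes (all? λ i → all? λ j → i +₉ j Fin.≟ j +₉ i)

  +₉-assoc : ∀ i j k → i +₉ j +₉ k ≡ i +₉ (j +₉ k)
  +₉-assoc = from-yes (all? λ i → all? λ j → all? λ k → i +₉ j +₉ k Fin.≟ i +₉ (j +₉ k))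

  +₉-right-comm : ∀ i j k → i +₉ j +₉ k ≡ i +₉ k +₉ j
  +₉-right-comm = from-yes (all? λ i → all? λ j → all? λ k → i +₉ j +₉ k Fin.≟ i +₉ k +₉ j)

  [_]₉ : ℤ → ℤ₉
  [ + zero ]₉        = # 0
  [ + suc n ]₉       = [ + n ]₉ +₉ # 1
  [ -[1+ zero ] ]₉   = # 8
  [ -[1+ suc n ] ]₉  = [ -[1+ n ] ]₉ +₉ # 8

  [1+z]₉ : ∀ z → [ ℤ.1ℤ ℤ.+ z ]₉ ≡ [ z ]₉ +₉ # 1
  [1+z]₉ (+ n)         = refl
  [1+z]₉ -[1+ zero ]   = refl
  [1+z]₉ -[1+ suc n ]  = begin
    [ -[1+ n ] ]₉                      ≡⟨ +₉-identityʳ [ -[1+ n ] ]₉ ⟨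
    [ -[1+ n ] ]₉ +₉ (# 8 +₉ # 1)      ≡⟨ +₉-assoc [ -[1+ n ] ]₉ (# 8) (# 1) ⟨
    [ -[1+ n ] ]₉ +₉ # 8 +₉ # 1        ∎
    where open ≡-Reasoning

  [-1+z]₉ : ∀ z → [ ℤ.-1ℤ ℤ.+ z ]₉ ≡ [ z ]₉ +₉ # 8
  [-1+z]₉ z = begin
    [ z′ ]₉                            ≡⟨ +₉-identityʳ [ z′ ]₉ ⟨
    [ z′ ]₉ +₉ (# 1 +₉ # 8)            ≡⟨ +₉-assoc [ z′ ]₉ (# 1) (# 8) ⟨
    [ z′ ]₉ +₉ # 1 +₉ # 8              ≡⟨ cong (_+₉ # 8) ([1+z]₉ z′) ⟨
    [ ℤ.1ℤ ℤ.+ z′ ]₉ +₉ # 8            ≡⟨ cong (λ x → [ x ]₉ +₉ # 8) (cancel z) ⟩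
    [ z ]₉ +₉ # 8                      ∎
    where
    open ≡-Reasoning
    z′ = ℤ.-1ℤ ℤ.+ z
    cancel : ∀ z → ℤ.1ℤ ℤ.+ (ℤ.-1ℤ ℤ.+ z) ≡ z
    cancel = solve-∀

  [+]₉ : ∀ a b → [ a ℤ.+ b ]₉ ≡ [ a ]₉ +₉ [ b ]₉
  [+]₉ (+ zero) b = trans (cong [_]₉ (ℤ.+-identityˡ b)) (sym (+₉-identityˡ [ b ]₉))
  [+]₉ (+ suc k) b = begin
    [ + suc k ℤ.+ b ]₉                 ≡⟨ cong [_]₉ (ℤ.+-assoc ℤ.1ℤ (+ k) b) ⟩
    [ ℤ.1ℤ ℤ.+ (+ k ℤ.+ b) ]₉          ≡⟨ [1+z]₉ (+ k ℤ.+ b) ⟩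
    [ + k ℤ.+ b ]₉ +₉ # 1              ≡⟨ cong (_+₉ # 1) ([+]₉ (+ k) b) ⟩
    [ + k ]₉ +₉ [ b ]₉ +₉ # 1          ≡⟨ +₉-right-comm [ + k ]₉ [ b ]₉ (# 1) ⟩
    [ + suc k ]₉ +₉ [ b ]₉             ∎
    where open ≡-Reasoning
  [+]₉ -[1+ zero ] b = trans ([-1+z]₉ b) (+₉-comm [ b ]₉ (# 8))
  [+]₉ -[1+ suc k ] b = begin
    [ -[1+ suc k ] ℤ.+ b ]₉            ≡⟨ cong [_]₉ (ℤ.+-assoc ℤ.-1ℤ -[1+ k ] b) ⟩
    [ ℤ.-1ℤ ℤ.+ (-[1+ k ] ℤ.+ b) ]₉    ≡⟨ [-1+z]₉ (-[1+ k ] ℤ.+ b) ⟩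
    [ -[1+ k ] ℤ.+ b ]₉ +₉ # 8         ≡⟨ cong (_+₉ # 8) ([+]₉ -[1+ k ] b) ⟩
    [ -[1+ k ] ]₉ +₉ [ b ]₉ +₉ # 8     ≡⟨ +₉-right-comm [ -[1+ k ] ]₉ [ b ]₉ (# 8) ⟩
    [ -[1+ suc k ] ]₉ +₉ [ b ]₉        ∎
    where open ≡-Reasoning

  phase : Vertex → ℤ
  phase (x , y) = x ℤ.+ (y ℤ.+ y)

  [phase-⊖]₉ : ∀ u δ → [ phase (u ⊖ δ) ]₉ ≡ [ phase u ]₉ +₉ [ ℤ.- phase δ ]₉
  [phase-⊖]₉ (x , y) (a , b) = trans (cong [_]₉ (linear x y a b)) ([+]₉ (phase (x , y)) (ℤ.- phase (a , b)))
    where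
    linear : ∀ x y a b → (x ℤ.- a) ℤ.+ ((y ℤ.- b) ℤ.+ (y ℤ.- b)) ≡ (x ℤ.+ (y ℤ.+ y)) ℤ.+ ℤ.- (a ℤ.+ (b ℤ.+ b))
    linear = solve-∀

  inCode : ℤ₉ → Bool
  inCode zero                    = true
  inCode (suc (suc (suc zero)))  = true
  inCode _                       = false

  code : Code
  code u = inCode [ phase u ]₉

  code-⊖ : ∀ u δ → code (u ⊖ δ) ≡ inCode ([ phase u ]₉ +₉ [ ℤ.- phase δ ]₉)
  code-⊖ u δ = cong inCode ([phase-⊖]₉ u δ)

  every-residue-covered : ∀ r → Any (λ ε → T (inCode (r +₉ [ ℤ.- phase ε ]₉))) Δ
  every-residue-covered = from-yes (all? λ r → Any.any? (λ ε → T? (inCode (r +₉ [ ℤ.- phase ε ]₉))) Δ)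

  code-covering : IsCovering code
  code-covering u with find (every-residue-covered [ phase u ]₉)
  ... | ε , ε∈Δ , inC = u ⊖ ε , InN-⊖ u ε∈Δ , trans (code-⊖ u ε) (Equivalence.to T-≡ inC)

  -- For u with [ phase u ]₉ ≡ r, the codeword u ⊖ ε lies in I(u) but not in I(u ⊖ δ).
  Separates : ℤ₉ → Vertex → Vertex → Set
  Separates r δ ε = T (inCode (r +₉ [ ℤ.- phase ε ]₉)) × ¬ ((ε ⊖ δ) ∈ Δ)

  separates⇒¬SameI : ∀ u δ → Any (Separates [ phase u ]₉ δ) Δ → ¬ SameI code u (u ⊖ δ)
  separates⇒¬SameI u δ separating same with find separating
  ... | ε , ε∈Δ , inC , ε⊖δ∉Δ =
    ε⊖δ∉Δ (subst (_∈ Δ) (⊖-⊖-⊖ u δ ε) (Equivalence.to (InN⇔⊖∈Δ (u ⊖ δ) (u ⊖ ε)) (proj₁ (proj₁ (same (u ⊖ ε)) uw))))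
    where
    uw : InI code u (u ⊖ ε)
    uw = InN-⊖ u ε∈Δ , trans (code-⊖ u ε) (Equivalence.to T-≡ inC)

  LocallySeparated : ℤ₉ → Vertex → Set
  LocallySeparated r δ = T (inCode r) ⊎ T (inCode r′) ⊎ Any (Separates r δ) Δ ⊎ Any (Separates r′ (0v ⊖ δ)) Δ
    where r′ = r +₉ [ ℤ.- phase δ ]₉

  every-residue-locally-separated : ∀ r → All (LocallySeparated r) unitSteps
  every-residue-locally-separated = from-yes (all? λ r → All.all? (locallySeparated? r) unitSteps)
    where
    separates? : ∀ r δ ε → Dec (Separates r δ ε)
    separates? r δ ε = T? (inCode (r +₉ [ ℤ.- phase ε ]₉)) ×-dec ¬? ((ε ⊖ δ) ∈? Δ)
    locallySeparated? : ∀ r δ → Dec (LocallySeparated r δ)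
    locallySeparated? r δ = T? (inCode r) ⊎-dec T? (inCode (r +₉ [ ℤ.- phase δ ]₉))
                            ⊎-dec Any.any? (separates? r δ) Δ
                            ⊎-dec Any.any? (separates? (r +₉ [ ℤ.- phase δ ]₉) (0v ⊖ δ)) Δ

  code-locating-step : ∀ u δ → δ ∈ unitSteps → ¬ (u ∈C code) → ¬ ((u ⊖ δ) ∈C code) → ¬ SameI code u (u ⊖ δ)
  code-locating-step u δ δ∈ u∉ v∉ = by-cases (All.lookup (every-residue-locally-separated [ phase u ]₉) δ∈)
    where
    by-cases : LocallySeparated [ phase u ]₉ δ → ¬ SameI code u (u ⊖ δ)
    by-cases (inj₁ inC)               = λ _ → u∉ (Equivalence.to T-≡ inC)
    by-cases (inj₂ (inj₁ inC))        = λ _ → v∉ (trans (code-⊖ u δ) (Equivalence.to T-≡ inC))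
    by-cases (inj₂ (inj₂ (inj₁ sep))) = separates⇒¬SameI u δ sep
    by-cases (inj₂ (inj₂ (inj₂ sep))) = λ same →
      separates⇒¬SameI (u ⊖ δ) (0v ⊖ δ) sep′ (subst (SameI code (u ⊖ δ)) (sym (⊖-⊖-neg u δ)) (swap ∘ same))
      where
      sep′ : Any (Separates [ phase (u ⊖ δ) ]₉ (0v ⊖ δ)) Δ
      sep′ = subst (λ r → Any (Separates r (0v ⊖ δ)) Δ) (sym ([phase-⊖]₉ u δ)) sep

  code-isLocalLD : IsLocalLD code
  code-isLocalLD = code-covering , locating
    where
    locating : ∀ u v → Adj u v → ¬ (u ∈C code) → ¬ (v ∈C code) → ¬ SameI code u v
    locating u v adj u∉ v∉ = subst (λ x → ¬ SameI code u x) (⊖-⊖-cancel u v)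
      (code-locating-step u (u ⊖ v) (Equivalence.to (Adj⇔⊖∈unitSteps u v) adj) u∉ (v∉ ∘ subst (_∈C code) (⊖-⊖-cancel u v)))

  code-periodic : ∀ x n j → code (x , coord n (9 + j)) ≡ code (x , coord n j)
  code-periodic x n j = cong inCode (begin
    [ phase (x , coord n (9 + j)) ]₉            ≡⟨ cong [_]₉ (shift x (+ j) (+ n)) ⟩
    [ phase (x , coord n j) ℤ.+ + 18 ]₉         ≡⟨ [+]₉ (phase (x , coord n j)) (+ 18) ⟩
    [ phase (x , coord n j) ]₉ +₉ # 0           ≡⟨ +₉-identityʳ [ phase (x , coord n j) ]₉ ⟩
    [ phase (x , coord n j) ]₉                  ∎)
    where
    open ≡-Reasoning
    shift : ∀ x j n → x ℤ.+ (((+ 9 ℤ.+ j) ℤ.- n) ℤ.+ ((+ 9 ℤ.+ j) ℤ.- n)) ≡ (x ℤ.+ ((j ℤ.- n) ℤ.+ (j ℤ.- n))) ℤ.+ + 18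
    shift = solve-∀

  code-period-count : ∀ x n → ∑[ j < 9 ] indicator (code (x , coord n j)) ≡ 2
  code-period-count x n =
    trans (∑-cong 9 (λ j → cong (indicator ∘ inCode) (row-phase j))) (period-count [ phase (x , coord n 0) ]₉)
    where
    row-phase : ∀ j → [ phase (x , coord n j) ]₉ ≡ [ phase (x , coord n 0) ]₉ +₉ [ + (j + j) ]₉
    row-phase j = trans (cong [_]₉ (step x (+ j) (+ n))) ([+]₉ (phase (x , coord n 0)) (+ (j + j)))
      where
      step : ∀ x j n → x ℤ.+ ((j ℤ.- n) ℤ.+ (j ℤ.- n)) ≡ (x ℤ.+ ((ℤ.0ℤ ℤ.- n) ℤ.+ (ℤ.0ℤ ℤ.- n))) ℤ.+ (j ℤ.+ j)
      step = solve-∀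
    period-count : ∀ r → ∑[ j < 9 ] indicator (inCode (r +₉ [ + (j + j) ]₉)) ≡ 2
    period-count = from-yes (all? λ r → ∑[ j < 9 ] indicator (inCode (r +₉ [ + (j + j) ]₉)) ℕ.≟ 2)

  code-box-bound : ∀ n → 9 * countIn code n ≤ side n * (2 * side n + 18)
  code-box-bound n = begin
    9 * countIn code n                     ≡⟨ cong (9 *_) (countIn≡∑Q code n) ⟩
    9 * ∑Q n (indicator ∘ code)            ≡⟨ ∑-*ˡ M 9 (λ i → ∑< M (row i)) ⟨
    ∑[ i < M ] (9 * ∑< M (row i))          ≤⟨ ∑-mono-≤ M (λ i → ∑-periodic-≤ 9 M (row i) (row-periodic i)) ⟩
    ∑[ i < M ] (∑< 9 (row i) * (M + 9))    ≡⟨ ∑-cong M (λ i → cong (_* (M + 9)) (code-period-count (coord n i) n)) ⟩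
    ∑[ i < M ] (2 * (M + 9))               ≡⟨ ∑-const M (2 * (M + 9)) ⟩
    M * (2 * (M + 9))                      ≡⟨ cong (M *_) (*-distribˡ-+ 2 M 9) ⟩
    M * (2 * M + 18)                       ∎
    where
    open ≤-Reasoning
    M = side n
    row : ℕ → ℕ → ℕ
    row i j = indicator (code (coord n i , coord n j))
    row-periodic : ∀ i j → row i (9 + j) ≡ row i j
    row-periodic i j = cong indicator (code-periodic (coord n i) n j)

-- Opened only now: this _+_ on ℚ would clash with the one on ℕ used above.
open import Data.Product using (_×_; _,_; ∃-syntax)
open import Data.Integer using (+_)
open import Data.Rational using (ℚ; _/_; _+_; Positive)
open Density
open PeriodicCode using (code; code-isLocalLD; code-box-bound)

mainTheorem17 : (∀ (C : Code) → IsLocalLD C → DensityAtLeast C ((+ 2) / 11)) ×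
    (∀ (ε : ℚ) → Positive ε → ∃[ C ] (IsLocalLD C × DensityAtMost C (((+ 2) / 9) + ε)))
mainTheorem17 = lower , upper
  where
  lower : ∀ C → IsLocalLD C → DensityAtLeast C ((+ 2) / 11)
  lower C lld = densityAtLeast-from-box-bound C 2 10 (Discharging.discharging C lld)
  code-density≤2/9 : DensityAtMost code ((+ 2) / 9)
  code-density≤2/9 = densityAtMost-from-box-bound code 2 8 18 code-box-bound
  upper : ∀ ε → Positive ε → ∃[ C ] (IsLocalLD C × DensityAtMost C (((+ 2) / 9) + ε))
  upper ε positive = code , code-isLocalLD , DensityAtMost-mono {code} (p≤p+q ((+ 2) / 9) ε {{positive}}) code-density≤2/9
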